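{- Fix integers $\ell>0$ and $t>0$. If $\mathfrak{C}$ is a family of linear codes over $\mathbb{F}$ such that $\kappa(\mathcal{C};\mathfrak{G}_\ell)\le t$ for all $\mathcal{C}\in\mathfrak{C}$, then $\mathfrak{C}$ is not asymptotically good.
   Context: $\mathbb{F}$ is a finite field; a linear code is a subspace $\mathcal{C}\subseteq\mathbb{F}^I$ for a finite index set $I$; $[n,k,d]$ means length, dimension, minimum distance. Graphs are finite. $E(v)$ is the set of edges at $v$. For a connected graph $\mathcal{G}=(V,E)$ and any map $\omega:I\to V$, a graphical model is $(\mathcal{G},\omega,(\mathcal{S}_e)_{e\in E},(C_v)_{v\in V})$ with $\mathcal{S}_e$ finite-dimensional $\mathbb{F}$-spaces and subspaces $C_v\subseteq\mathbb{F}^{\omega^{ -1}(v)}\oplus\bigoplus_{e\in E(v)}\mathcal{S}_e$; its full behavior $\mathfrak{B}$ is the set of $\mathbf{b}=((x_i)_{i\in I},(\mathbf{s}_e)_{e\in E})$ with $((x_i)_{i\in\omega^{ -1}(v)},(\mathbf{s}_e)_{e\in E(v)})\in C_v$ for all $v$; it is essential if each $C_v$ and each $\mathcal{S}_e$ equals the corresponding projection of $\mathfrak{B}$. A realization of $\mathcal{C}$ extending $(\mathcal{G},\omega)$ is an essential graphical model whose full behavior projects onto $I$ exactly as $\mathcal{C}$; $\kappa(\Gamma)=\max_v\dim(C_v)$; $\kappa(\mathcal{C};\mathcal{G},\omega)$ is the minimum of $\kappa(\Gamma)$ over such realizations; $\kappa(\mathcal{C};\mathcal{G})=\min_\omega\kappa(\mathcal{C};\mathcal{G},\omega)$;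 for a family $\mathfrak{G}$ of connected graphs, $\kappa(\mathcal{C};\mathfrak{G})=\min_{\mathcal{G}\in\mathfrak{G}}\kappa(\mathcal{C};\mathcal{G})$. For $W\subseteq V$, $N(W)$ is the set of vertices adjacent to a vertex of $W$; $(V_0,\ldots,V_\delta)$ is a star partition of $V$ if the $V_i$ are pairwise disjoint with union $V$ and $N(V_i)\subseteq V_i\cup V_0$ for $i\ge1$. For $z$ of degree $\delta$ in a tree $T$, $T_1^{(z)},\ldots,T_\delta^{(z)}$ are the components of $T-z$; $\beta(X)=\bigcup_{x\in X}\beta(x)$. A vertex-cut tree of $\mathcal{G}$ is $(T,\beta)$, $T$ a tree, $\beta:V(T)\to2^{V(\mathcal{G})}$, with (VC1) $\beta(V(T))=V(\mathcal{G})$; (VC2) $\beta(x)\cap\beta(y)\subseteq\beta(z)$ whenever $z$ lies on the path from $x$ to $y$ in $T$; (VC3) for each $z$ of degree $\delta$, $(\beta(z),V_1,\ldots,V_\delta)$ with $V_i=\beta(V(T_i^{(z)}))\setminus\beta(z)$ is a star partition of $V(\mathcal{G})$. Its vc-width is $\max_z|\beta(z)|$; the vc-treewidth of $\mathcal{G}$ is the least vc-width of a vertex-cut tree of $\mathcal{G}$. $\mathfrak{G}_\ell$ denotes the family of all connected graphs of vc-treewidth at most $\ell$. A code family $\mathfrak{C}$ is asymptotically good if there is a sequence of $[n_i,k_i,d_i]$ codes $\mathcal{C}^{(i)}\in\mathfrak{C}$ with $n_i\to\infty$ and both $\liminf_i k_i/n_i>0$ and $\liminf_i d_i/n_i>0$.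 -}

module Defs where

open import Level using () renaming (suc to lsuc)
open import Data.Nat using (ℕ; zero; suc; _≤_; _<_) renaming (_+_ to _+ℕ_; _*_ to _*ℕ_)
open import Data.Fin using (Fin; toℕ) renaming (zero to fzero; suc to fsuc)
open import Data.Fin.Subset using (Subset; ∣_∣) renaming (_∈_ to _∈ₛ_; _∉_ to _∉ₛ_)
open import Data.Vec using (Vec; []; _∷_; lookup)
open import Data.List using (List; []; _∷_; length)
open import Data.List.Membership.Propositional using () renaming (_∈_ to _∈ₗ_; _∉_ to _∉ₗ_)
open import Data.List.Relation.Unary.Unique.Propositional using (Unique)
open import Data.Product using (Σ; ∃; _×_; _,_; proj₁; proj₂)
open import Data.Sum using (_⊎_; inj₁; inj₂)
open import Data.Bool using (Bool; true; false)
open import Data.Empty using (⊥)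
open import Relation.Binary.PropositionalEquality using (_≡_; _≢_)
open import Relation.Binary.Definitions using (DecidableEquality)
open import Relation.Nullary using (¬_; yes; no)
open import Relation.Binary.Construct.Closure.ReflexiveTransitive using (Star)
open import Function.Bundles using (_⇔_)

record FiniteField : Set₁ where
  infixl 6 _+_
  infixl 7 _*_
  field
    Carrier    : Set
    _+_ _*_    : Carrier → Carrier → Carrier
    0# 1#      : Carrier
    -_         : Carrier → Carrier
    +-assoc    : ∀ x y z → (x + y) + z ≡ x + (y + z)
    +-comm     : ∀ x y → x + y ≡ y + x
    +-identityˡ : ∀ x → 0# + x ≡ x
    -‿inverseˡ : ∀ x → (- x) + x ≡ 0#
    *-assoc    : ∀ x y z → (x * y) * z ≡ x * (y * z)
    *-comm     : ∀ x y → x * y ≡ y * x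
    *-identityˡ : ∀ x → 1# * x ≡ x
    distribˡ   : ∀ x y z → x * (y + z) ≡ (x * y) + (x * z)
    0≢1        : 0# ≢ 1#
    inverse    : ∀ x → x ≢ 0# → ∃ λ y → x * y ≡ 1#
    _≟_        : DecidableEquality Carrier
    elements   : List Carrier
    complete   : ∀ x → x ∈ₗ elements

record Graph : Set where
  field
    nV     : ℕ
    adj    : Fin nV → Fin nV → Bool
    sym    : ∀ u v → adj u v ≡ adj v u
    irrefl : ∀ v → adj v v ≡ false

module _ (G : Graph) where
  open Graph G

  Vtx : Set
  Vtx = Fin nV

  Adj : Vtx → Vtx → Set
  Adj u v = adj u v ≡ true

  Connected : Set
  Connected = ∀ u v → Star Adj u v

  -- Edge {u,v} represented once, with toℕ u < toℕ v.
  Edge : Set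
  Edge = Σ (Vtx × Vtx) λ p → toℕ (proj₁ p) < toℕ (proj₂ p) × Adj (proj₁ p) (proj₂ p)

  Incident : Edge → Vtx → Set
  Incident e v = proj₁ (proj₁ e) ≡ v ⊎ proj₂ (proj₁ e) ≡ v

  data Chain : Vtx → Vtx → List Vtx → Set where
    single : ∀ x → Chain x x (x ∷ [])
    step   : ∀ {x y z p} → Adj x y → Chain y z p → Chain x z (x ∷ p)

  Path : Vtx → Vtx → List Vtx → Set
  Path x y p = Chain x y p × Unique p

  HasCycle : Set
  HasCycle = Σ Vtx λ x → Σ Vtx λ y → Σ (List Vtx) λ p →
               Path x y p × Adj y x × 3 ≤ length p

  IsTree : Set
  IsTree = Connected × ¬ HasCycle

  OnPath : Vtx → Vtx → Vtx → Set
  OnPath x y z = Σ (List Vtx) λ p → Path x y p × z ∈ₗ p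

  -- y lies in the component of G - z containing w
  InComponent : Vtx → Vtx → Vtx → Set
  InComponent z w y = Σ (List Vtx) λ p → Path w y p × z ∉ₗ p

record VertexCutTree (G : Graph) : Set where
  field
    T    : Graph
    tree : IsTree T
    β    : Vtx T → Subset (Graph.nV G)

  -- V_w = β(V(T_w)) \ β(z), where T_w is the component of T - z containing
  -- the neighbour w of z (components of T - z ↔ neighbours of z)
  Branch : Vtx T → Vtx T → Vtx G → Set
  Branch z w g = (Σ (Vtx T) λ y → InComponent T z w y × g ∈ₛ β y) × g ∉ₛ β z

  field
    vc1 : ∀ g → Σ (Vtx T) λ x → g ∈ₛ β x
    vc2 : ∀ x y z g → OnPath T x y z → g ∈ₛ β x → g ∈ₛ β y → g ∈ₛ β z
    -- vc3: (β(z), V_1, …, V_δ) is a star partition of V(G)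
    vc3-disjoint : ∀ z w w' g → Adj T z w → Adj T z w' → w ≢ w' →
                   Branch z w g → Branch z w' g → ⊥
    vc3-cover    : ∀ z g → g ∈ₛ β z ⊎ (Σ (Vtx T) λ w → Adj T z w × Branch z w g)
    vc3-star     : ∀ z w g g' → Adj T z w → Branch z w g → Adj G g g' →
                   Branch z w g' ⊎ g' ∈ₛ β z

  vcWidthAtMost : ℕ → Set
  vcWidthAtMost ℓ = ∀ z → ∣ β z ∣ ≤ ℓ

InGℓ : ℕ → Graph → Set
InGℓ ℓ G = Connected G × Σ (VertexCutTree G) λ X → VertexCutTree.vcWidthAtMost X ℓ

module _ (F : FiniteField) where
  open FiniteField F

  record Subspace (J : Set) : Set₁ where
    field
      mem     : (J → Carrier) → Set
      mem-ext : ∀ {x y} → mem x → (∀ j → x j ≡ y j) → mem y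
      mem-0   : mem (λ _ → 0#)
      mem-+   : ∀ {x y} → mem x → mem y → mem (λ j → x j + y j)
      mem-*   : ∀ a {x} → mem x → mem (λ j → a * x j)

  lincomb : ∀ {J : Set} {k} → Vec Carrier k → Vec (J → Carrier) k → J → Carrier
  lincomb []       []       j = 0#
  lincomb (c ∷ cs) (b ∷ bs) j = c * b j + lincomb cs bs j

  HasDim : ∀ {J : Set} → Subspace J → ℕ → Set
  HasDim {J} S k = Σ (Vec (J → Carrier) k) λ B →
      (∀ i → Subspace.mem S (lookup B i))
    × (∀ c → (∀ j → lincomb c B j ≡ 0#) → ∀ i → lookup c i ≡ 0#)
    × (∀ x → Subspace.mem S x → Σ (Vec Carrier k) λ c → ∀ j → lincomb c B j ≡ x j)

  DimAtMost : ∀ {J : Set} → Subspace J → ℕ → Set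
  DimAtMost S t = Σ ℕ λ k → k ≤ t × HasDim S k

  Code : ℕ → Set₁
  Code n = Subspace (Fin n)

  weight : ∀ {n} → (Fin n → Carrier) → ℕ
  weight {zero}  x = 0
  weight {suc n} x with x fzero ≟ 0#
  ... | yes _ = weight (λ i → x (fsuc i))
  ... | no  _ = suc (weight (λ i → x (fsuc i)))

  Nonzero : ∀ {n} → (Fin n → Carrier) → Set
  Nonzero x = Σ _ λ i → x i ≢ 0#

  MinDist : ∀ {n} → Code n → ℕ → Set
  MinDist C d =
      (Σ _ λ x → Subspace.mem C x × Nonzero x × weight x ≡ d)
    × (∀ x → Subspace.mem C x → Nonzero x → d ≤ weight x)

  -- Graphical models (state spaces S_e = F^(d e))

  LocalIdx : ∀ {n} (G : Graph) → (Fin n → Vtx G) → (Edge G → ℕ) → Vtx G → Set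
  LocalIdx {n} G ω d v =
    (Σ (Fin n) λ i → ω i ≡ v) ⊎ (Σ (Edge G) λ e → Incident G e v × Fin (d e))

  record GraphicalModel (n : ℕ) (G : Graph) (ω : Fin n → Vtx G) : Set₁ where
    field
      stDim : Edge G → ℕ
      Cv    : (v : Vtx G) → Subspace (LocalIdx G ω stDim v)

    States : Set
    States = (e : Edge G) → Fin (stDim e) → Carrier

    restrict : (Fin n → Carrier) → States → (v : Vtx G) → LocalIdx G ω stDim v → Carrier
    restrict x s v (inj₁ (i , _))     = x i
    restrict x s v (inj₂ (e , _ , k)) = s e k

    InBehavior : (Fin n → Carrier) → States → Set
    InBehavior x s = ∀ v → Subspace.mem (Cv v) (restrict x s v)

    Essential : Set
    Essential =
        (∀ v y → Subspace.mem (Cv v) y ⇔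
           (Σ (Fin n → Carrier) λ x → Σ States λ s →
              InBehavior x s × (∀ j → restrict x s v j ≡ y j)))
      × (∀ e (σ : Fin (stDim e) → Carrier) →
           Σ (Fin n → Carrier) λ x → Σ States λ s →
              InBehavior x s × (∀ k → s e k ≡ σ k))

    Realizes : Code n → Set
    Realizes C = Essential ×
      (∀ y → Subspace.mem C y ⇔
         (Σ (Fin n → Carrier) λ x → Σ States λ s →
            InBehavior x s × (∀ i → x i ≡ y i)))

    κAtMost : ℕ → Set
    κAtMost t = ∀ v → DimAtMost (Cv v) t

  κGℓAtMost : ∀ {n} → ℕ → Code n → ℕ → Set₁
  κGℓAtMost {n} ℓ C t =
    Σ Graph λ G → InGℓ ℓ G × Σ (Fin n → Vtx G) λ ω →
      Σ (GraphicalModel n G ω) λ Γ →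
        GraphicalModel.Realizes Γ C × GraphicalModel.κAtMost Γ t

  -- Asymptotically good code families.
  -- liminf k_i/n_i > 0 is rendered as: ∃ a,b ≥ 1 and N with a·n_i ≤ b·k_i for i ≥ N
  -- (i.e. k_i/n_i ≥ a/b eventually); likewise for d_i.

  CodeFamily : Set₁
  CodeFamily = (n : ℕ) → Code n → Set

  AsymptoticallyGood : CodeFamily → Set₁
  AsymptoticallyGood 𝔉 =
    Σ (ℕ → ℕ) λ ns → Σ ((i : ℕ) → Code (ns i)) λ cs →
        (∀ i → 𝔉 (ns i) (cs i))
      × (∀ M → Σ ℕ λ N → ∀ i → N ≤ i → M ≤ ns i)
      × (Σ ℕ λ a → Σ ℕ λ b → 1 ≤ a × 1 ≤ b × Σ ℕ λ N → ∀ i → N ≤ i →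
           (Σ ℕ λ k → HasDim (cs i) k × a *ℕ ns i ≤ b *ℕ k)
         × (Σ ℕ λ d → MinDist (cs i) d × a *ℕ ns i ≤ b *ℕ d))

module Submission where

-- Let C be an [n, k, d] code realized on a graph G ∈ 𝔊_ℓ with local codes of
-- dimension at most t, and let q = |F|.  We prove k · d ≤ 2 q t ℓ n
-- (rate-distance-bound), which is incompatible with k, d ≥ (a/b) n once n is large.
--
--  * Separators: weigh a region of G by the number of coordinates it carries.
--    Walking in the vertex-cut tree towards a branch holding more than half the
--    weight must stop (the tree is acyclic), at a centroid whose branches each
--    hold at most half.
--  * Decomposition: cutting recursively at centroids until every region weighs
--    less than d uses L separators, with d L ≤ 2 n.
--  * Vanishing: a behaviour vanishing on the bags of all separators vanishes,
--    since cutting it down to a light region gives a codeword of weight < d.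
--  * Dimension: so a codeword is determined by its local data at the ≤ ℓ L
--    vertices of these bags, at most t field elements each; encoding the 2^k
--    codewords with 0/1 coordinates in a basis gives k ≤ q t ℓ L.

open import Defs
open import Data.Nat using (ℕ; _<_)
open import Relation.Nullary using (¬_)

open import Data.Fin using (Fin; funToFin; finToFun; combine; fromℕ<) renaming (zero to fzero; suc to fsuc)
open import Data.Fin.Subset using (Subset; ∣_∣) renaming (_∈_ to _∈ₛ_)
open import Data.Vec as Vec using (Vec; []; _∷_; lookup; tabulate; zipWith) renaming (_++_ to _++ᵥ_)
open import Data.Vec.Properties using (lookup∘tabulate; lookup-zipWith; tabulate∘lookup; tabulate-cong; ++-injective)
open import Data.List as List using (List; []; _∷_; length; _++_; concatMap)
open import Data.List.Properties using (length-map; length-++)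
open import Data.List.Membership.Propositional using (_∈_; _∉_)
open import Data.List.Membership.Propositional.Properties using (∈-lookup; ∈-++⁺ˡ; ∈-++⁺ʳ; ∈-map⁺; ∈-concatMap⁺)
open import Data.List.Relation.Unary.Any as Any using (here; there; index)
open import Data.List.Relation.Unary.Any.Properties using (lookup-index)
open import Data.List.Relation.Unary.All as All using (All; []; _∷_)
open import Data.List.Relation.Unary.Unique.Propositional using (Unique)
open import Data.List.Relation.Unary.AllPairs using ([]; _∷_)
open import Data.Bool using (Bool; true; false; _∧_; _∨_; if_then_else_)
open import Data.Bool.Properties using (∧-conicalˡ; ∧-conicalʳ; ∨-zeroʳ; ∨-identityʳ)
open import Data.Product using (Σ; _×_; _,_; proj₁; proj₂)
open import Data.Sum using (_⊎_; inj₁; inj₂)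
open import Data.Empty using (⊥; ⊥-elim)
open import Relation.Nullary using (yes; no; does; Dec)
open import Relation.Binary.PropositionalEquality
open import Function using (_∘_)
open import Function.Bundles using (Equivalence)
open import Function.Definitions using (Injective)

-- Field arithmetic needed below.  Subtraction is written with the scalar -1 so
-- that it visibly preserves every subspace.
module FieldFacts (F : FiniteField) where
  open FiniteField F
  open ≡-Reasoning

  +-identityʳ : ∀ x → x + 0# ≡ x
  +-identityʳ x = trans (+-comm x 0#) (+-identityˡ x)

  distribʳ : ∀ x y z → (y + z) * x ≡ y * x + z * x
  distribʳ x y z = trans (*-comm (y + z) x) (trans (distribˡ x y z) (cong₂ _+_ (*-comm x y) (*-comm x z)))

  +-cancel : ∀ a b → a + b ≡ a → b ≡ 0#
  +-cancel a b a+b≡a = begin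
    b               ≡⟨ sym (+-identityˡ b) ⟩
    0# + b          ≡⟨ cong (_+ b) (sym (-‿inverseˡ a)) ⟩
    ((- a) + a) + b ≡⟨ +-assoc (- a) a b ⟩
    (- a) + (a + b) ≡⟨ cong ((- a) +_) a+b≡a ⟩
    (- a) + a       ≡⟨ -‿inverseˡ a ⟩
    0#              ∎

  -- 0 x = 0 x + 0 x, so 0 x = 0.
  *-zeroˡ : ∀ x → 0# * x ≡ 0#
  *-zeroˡ x = +-cancel (0# * x) (0# * x) (trans (sym (distribʳ x 0# 0#)) (cong (_* x) (+-identityˡ 0#)))

  infixl 6 _−_
  _−_ : Carrier → Carrier → Carrier
  x − y = x + (- 1#) * y

  -1*y+y≡0 : ∀ y → (- 1#) * y + y ≡ 0#
  -1*y+y≡0 y = begin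
    (- 1#) * y + y      ≡⟨ cong ((- 1#) * y +_) (sym (*-identityˡ y)) ⟩
    (- 1#) * y + 1# * y ≡⟨ sym (distribʳ y (- 1#) 1#) ⟩
    ((- 1#) + 1#) * y   ≡⟨ cong (_* y) (-‿inverseˡ 1#) ⟩
    0# * y              ≡⟨ *-zeroˡ y ⟩
    0#                  ∎

  x−x≡0 : ∀ x → x − x ≡ 0#
  x−x≡0 x = trans (+-comm x _) (-1*y+y≡0 x)

  x−y≡0⇒x≡y : ∀ x y → x − y ≡ 0# → x ≡ y
  x−y≡0⇒x≡y x y x−y≡0 = begin
    x                      ≡⟨ sym (+-identityʳ x) ⟩
    x + 0#                 ≡⟨ cong (x +_) (sym (-1*y+y≡0 y)) ⟩
    x + ((- 1#) * y + y)   ≡⟨ sym (+-assoc x _ y) ⟩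
    (x − y) + y            ≡⟨ cong (_+ y) x−y≡0 ⟩
    0# + y                 ≡⟨ +-identityˡ y ⟩
    y                      ∎

  −-distrib-+ : ∀ a b c e → (a + b) − (c + e) ≡ (a − c) + (b − e)
  −-distrib-+ a b c e = begin
    (a + b) + (- 1#) * (c + e)              ≡⟨ cong ((a + b) +_) (distribˡ (- 1#) c e) ⟩
    (a + b) + ((- 1#) * c + (- 1#) * e)     ≡⟨ +-assoc a b _ ⟩
    a + (b + ((- 1#) * c + (- 1#) * e))     ≡⟨ cong (a +_) (sym (+-assoc b _ _)) ⟩
    a + ((b + (- 1#) * c) + (- 1#) * e)     ≡⟨ cong (λ u → a + (u + (- 1#) * e)) (+-comm b _) ⟩
    a + (((- 1#) * c + b) + (- 1#) * e)     ≡⟨ cong (a +_) (+-assoc _ b _) ⟩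
    a + ((- 1#) * c + (b + (- 1#) * e))     ≡⟨ sym (+-assoc a _ _) ⟩
    (a − c) + (b − e)                       ∎

  −-distrib-* : ∀ a c b → (a − c) * b ≡ a * b − c * b
  −-distrib-* a c b = trans (distribʳ b a _) (cong (a * b +_) (*-assoc (- 1#) c b))

  mem-− : ∀ {J : Set} (S : Subspace F J) {x y} → Subspace.mem S x → Subspace.mem S y →
          Subspace.mem S (λ j → x j − y j)
  mem-− S x∈S y∈S = Subspace.mem-+ S x∈S (Subspace.mem-* S (- 1#) y∈S)

  lincomb-mem : ∀ {J : Set} {k} (S : Subspace F J) (c : Vec Carrier k) (B : Vec (J → Carrier) k) →
    (∀ i → Subspace.mem S (lookup B i)) → Subspace.mem S (lincomb F c B)
  lincomb-mem S []      []      B⊆S = Subspace.mem-0 S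
  lincomb-mem S (a ∷ c) (b ∷ B) B⊆S =
    Subspace.mem-+ S (Subspace.mem-* S a (B⊆S fzero)) (lincomb-mem S c B (B⊆S ∘ fsuc))

  lincomb-− : ∀ {J : Set} {k} (c c' : Vec Carrier k) (B : Vec (J → Carrier) k) j →
    lincomb F (zipWith _−_ c c') B j ≡ lincomb F c B j − lincomb F c' B j
  lincomb-− []      []        []      j = sym (x−x≡0 0#)
  lincomb-− (a ∷ c) (a' ∷ c') (b ∷ B) j = begin
    (a − a') * b j + lincomb F (zipWith _−_ c c') B j
      ≡⟨ cong₂ _+_ (−-distrib-* a a' (b j)) (lincomb-− c c' B j) ⟩
    (a * b j − a' * b j) + (lincomb F c B j − lincomb F c' B j)
      ≡⟨ sym (−-distrib-+ (a * b j) _ (a' * b j) _) ⟩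
    (a * b j + lincomb F c B j) − (a' * b j + lincomb F c' B j) ∎

  lincomb-injective : ∀ {J : Set} {k} (B : Vec (J → Carrier) k) →
    (∀ c → (∀ j → lincomb F c B j ≡ 0#) → ∀ i → lookup c i ≡ 0#) →
    ∀ c c' → (∀ j → lincomb F c B j ≡ lincomb F c' B j) → ∀ i → lookup c i ≡ lookup c' i
  lincomb-injective B independent c c' same i = x−y≡0⇒x≡y _ _ (begin
    lookup c i − lookup c' i      ≡⟨ sym (lookup-zipWith _−_ i c c') ⟩
    lookup (zipWith _−_ c c') i   ≡⟨ independent (zipWith _−_ c c') difference-vanishes i ⟩
    0#                            ∎)
    where
    difference-vanishes : ∀ j → lincomb F (zipWith _−_ c c') B j ≡ 0#
    difference-vanishes j =
      trans (lincomb-− c c' B j) (trans (cong (_ −_) (sym (same j))) (x−x≡0 _))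

  bit : Fin 2 → Carrier
  bit fzero    = 0#
  bit (fsuc _) = 1#

  bit-injective : Injective _≡_ _≡_ bit
  bit-injective {fzero}        {fzero}        _ = refl
  bit-injective {fzero}        {fsuc fzero}   0≡1 = ⊥-elim (0≢1 0≡1)
  bit-injective {fsuc fzero}   {fzero}        1≡0 = ⊥-elim (0≢1 (sym 1≡0))
  bit-injective {fsuc fzero}   {fsuc fzero}   _ = refl

-- Natural-number arithmetic is imported only here, after the field section,
-- so that its operators do not clash with those of the field.
open import Data.Nat using (zero; suc; _+_; _*_; _^_; _≤_; z≤n; s≤s; _<?_; _≤?_)
open import Data.Nat.Properties
  using (≤-refl; ≤-trans; ≤-reflexive; ≤-pred; <-irrefl; <⇒≤; <⇒≱; ≰⇒>; ≮⇒≥; n≤0⇒n≡0; n≤1+n;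
         m≤m+n; m≤n+m; m<m+n; m≤n*m; +-comm; +-assoc; +-identityʳ; +-suc; +-mono-≤; +-mono-<;
         +-monoʳ-≤; +-monoˡ-≤; *-suc; *-zeroʳ; *-identityʳ; *-distribˡ-+; *-mono-≤; *-monoʳ-≤;
         *-monoˡ-≤; *-cancelʳ-≤; ^-monoˡ-≤; ^-monoʳ-<; ^-*-assoc; module ≤-Reasoning)
open import Data.Nat.Solver using (module +-*-Solver)
open import Data.Fin using (_≟_)
open import Data.Fin.Properties using (any?; injective⇒≤; funToFin-finToFin; finToFun-funToFin)

∑ : (m : ℕ) → (Fin m → ℕ) → ℕ
∑ zero    f = 0
∑ (suc m) f = f fzero + ∑ m (f ∘ fsuc)

∑-mono : ∀ m {f g : Fin m → ℕ} → (∀ i → f i ≤ g i) → ∑ m f ≤ ∑ m g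
∑-mono zero    f≤g = z≤n
∑-mono (suc m) f≤g = +-mono-≤ (f≤g fzero) (∑-mono m (f≤g ∘ fsuc))

∑-zero : ∀ m {f : Fin m → ℕ} → (∀ i → f i ≡ 0) → ∑ m f ≡ 0
∑-zero zero    f≡0 = refl
∑-zero (suc m) f≡0 rewrite f≡0 fzero = ∑-zero m (f≡0 ∘ fsuc)

∑-+ : ∀ m (f g : Fin m → ℕ) → ∑ m (λ i → f i + g i) ≡ ∑ m f + ∑ m g
∑-+ zero    f g = refl
∑-+ (suc m) f g = begin
    (f fzero + g fzero) + ∑ m (λ i → f (fsuc i) + g (fsuc i))
  ≡⟨ cong ((f fzero + g fzero) +_) (∑-+ m (f ∘ fsuc) (g ∘ fsuc)) ⟩
    (f fzero + g fzero) + (∑ m (f ∘ fsuc) + ∑ m (g ∘ fsuc))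
  ≡⟨ interchange (f fzero) (g fzero) (∑ m (f ∘ fsuc)) (∑ m (g ∘ fsuc)) ⟩
    (f fzero + ∑ m (f ∘ fsuc)) + (g fzero + ∑ m (g ∘ fsuc))
  ∎
  where
  open ≡-Reasoning
  open +-*-Solver
  interchange : ∀ a b c e → (a + b) + (c + e) ≡ (a + c) + (b + e)
  interchange = solve 4 (λ a b c e → (a :+ b) :+ (c :+ e) := (a :+ c) :+ (b :+ e)) refl

∑-* : ∀ m c (f : Fin m → ℕ) → ∑ m (λ i → c * f i) ≡ c * ∑ m f
∑-* zero    c f = sym (*-zeroʳ c)
∑-* (suc m) c f = trans (cong (c * f fzero +_) (∑-* m c (f ∘ fsuc)))
                        (sym (*-distribˡ-+ c (f fzero) _))

∑-swap : ∀ m k (f : Fin m → Fin k → ℕ) →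
  ∑ m (λ i → ∑ k (f i)) ≡ ∑ k (λ j → ∑ m (λ i → f i j))
∑-swap zero    k f = sym (∑-zero k (λ _ → refl))
∑-swap (suc m) k f = trans (cong (∑ k (f fzero) +_) (∑-swap m k (f ∘ fsuc)))
                           (sym (∑-+ k (f fzero) _))

∑-pos : ∀ m (f : Fin m → ℕ) → 0 < ∑ m f → Σ (Fin m) λ i → 0 < f i
∑-pos (suc m) f pos with f fzero in eq
... | suc _ = fzero , subst (0 <_) (sym eq) (s≤s z≤n)
... | zero with ∑-pos m (f ∘ fsuc) pos
...   | i , fi>0 = fsuc i , fi>0

∑-linear-bound : ∀ m d (a b : Fin m → ℕ) c (f : Fin m → ℕ) → (∀ w → d * a w + d * b w ≤ c * f w) →
  d * ∑ m a + d * ∑ m b ≤ c * ∑ m f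
∑-linear-bound m d a b c f bound = begin
  d * ∑ m a + d * ∑ m b                 ≡⟨ sym (cong₂ _+_ (∑-* m d a) (∑-* m d b)) ⟩
  ∑ m (λ w → d * a w) + ∑ m (λ w → d * b w) ≡⟨ sym (∑-+ m _ _) ⟩
  ∑ m (λ w → d * a w + d * b w)         ≤⟨ ∑-mono m bound ⟩
  ∑ m (λ w → c * f w)                   ≡⟨ ∑-* m c f ⟩
  c * ∑ m f                             ∎
  where open ≤-Reasoning

χ : Bool → ℕ
χ true  = 1
χ false = 0

χ-pos : ∀ {b} → 0 < χ b → b ≡ true
χ-pos {true} _ = refl

double-pos : ∀ {m a} → m < 2 * a → 0 < a
double-pos {a = suc a} _ = s≤s z≤n

∑-point : ∀ m (a : Fin m) → ∑ m (λ w → χ (does (a ≟ w))) ≡ 1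
∑-point (suc m) fzero    = cong suc (∑-zero m (λ _ → refl))
∑-point (suc m) (fsuc a) = ∑-point m a

∑-one : ∀ m → ∑ m (λ _ → 1) ≡ m
∑-one zero    = refl
∑-one (suc m) = cong suc (∑-one m)

module WeightFacts (F : FiniteField) where
  open FiniteField F using (Carrier; 0#) renaming (_≟_ to _≟F_)

  weight-≤-support : ∀ {m} (x : Fin m → Carrier) (Q : Fin m → Bool) →
    (∀ i → Q i ≡ false → x i ≡ 0#) → weight F x ≤ ∑ m (χ ∘ Q)
  weight-≤-support {zero}  x Q outside = z≤n
  weight-≤-support {suc m} x Q outside with x fzero ≟F 0# | Q fzero in Q0
  ... | yes _  | q     = ≤-trans (weight-≤-support (x ∘ fsuc) (Q ∘ fsuc) (outside ∘ fsuc)) (m≤n+m _ (χ q))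
  ... | no _   | true  = s≤s (weight-≤-support (x ∘ fsuc) (Q ∘ fsuc) (outside ∘ fsuc))
  ... | no x≢0 | false = ⊥-elim (x≢0 (outside fzero Q0))

  weight-pos : ∀ {m} (x : Fin m → Carrier) (i : Fin m) → x i ≢ 0# → 1 ≤ weight F x
  weight-pos {suc m} x i xi≢0 with x fzero ≟F 0# | i
  ... | no _   | _      = s≤s z≤n
  ... | yes x0 | fzero  = ⊥-elim (xi≢0 x0)
  ... | yes _  | fsuc j = weight-pos (x ∘ fsuc) j xi≢0

funToFin-cong : ∀ {m n} {f g : Fin m → Fin n} → (∀ i → f i ≡ g i) → funToFin f ≡ funToFin g
funToFin-cong {zero}  f≗g = refl
funToFin-cong {suc m} f≗g = cong₂ combine (f≗g fzero) (funToFin-cong (f≗g ∘ fsuc))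

n<2^n : ∀ n → n < 2 ^ n
n<2^n zero    = s≤s z≤n
n<2^n (suc n) = +-mono-≤ (≤-trans (s≤s z≤n) (n<2^n n))
                         (≤-trans (n<2^n n) (≤-reflexive (sym (+-identityʳ (2 ^ n)))))

-- Taking logarithms crudely: q ^ M ≤ (2 ^ q) ^ M = 2 ^ (q * M).
2^k≤q^M⇒k≤q*M : ∀ q k M → 2 ^ k ≤ q ^ M → k ≤ q * M
2^k≤q^M⇒k≤q*M q k M 2^k≤q^M with k ≤? q * M
... | yes k≤qM = k≤qM
... | no  k≰qM = ⊥-elim (<⇒≱ q^M<2^k 2^k≤q^M)
  where
  open ≤-Reasoning
  q^M<2^k : q ^ M < 2 ^ k
  q^M<2^k = begin-strict
    q ^ M       ≤⟨ ^-monoˡ-≤ M (<⇒≤ (n<2^n q)) ⟩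
    (2 ^ q) ^ M ≡⟨ ^-*-assoc 2 q M ⟩
    2 ^ (q * M) <⟨ ^-monoʳ-< 2 (s≤s (s≤s z≤n)) (≰⇒> k≰qM) ⟩
    2 ^ k       ∎

module Counting {A : Set} (q : ℕ) (code : A → Fin q) (code-injective : Injective _≡_ _≡_ code) where

  encode : ∀ {M} → Vec A M → Fin (q ^ M)
  encode v = funToFin (code ∘ lookup v)

  encode-injective : ∀ {M} {u v : Vec A M} → encode u ≡ encode v → u ≡ v
  encode-injective {u = u} {v} eq = begin
    u                  ≡⟨ sym (tabulate∘lookup u) ⟩
    tabulate (lookup u) ≡⟨ tabulate-cong same-letters ⟩
    tabulate (lookup v) ≡⟨ tabulate∘lookup v ⟩
    v                  ∎
    where
    open ≡-Reasoning
    same-letters : ∀ i → lookup u i ≡ lookup v i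
    same-letters i = code-injective (begin
      code (lookup u i)         ≡⟨ sym (finToFun-funToFin (code ∘ lookup u) i) ⟩
      finToFun (encode u) i     ≡⟨ cong (λ c → finToFun c i) eq ⟩
      finToFun (encode v) i     ≡⟨ finToFun-funToFin (code ∘ lookup v) i ⟩
      code (lookup v i)         ∎)

  -- Fin (2 ^ k) codes the bit strings, so an injection of bit strings into words
  -- yields an injection Fin (2 ^ k) → Fin (q ^ M).
  2^k≤q^M : ∀ k M (f : (Fin k → Fin 2) → Vec A M) →
    (∀ u v → f u ≡ f v → ∀ i → u i ≡ v i) → 2 ^ k ≤ q ^ M
  2^k≤q^M k M f f-injective = injective⇒≤ {f = encode ∘ f ∘ bits} λ {i} {j} eq → begin
    i                  ≡⟨ sym (funToFin-finToFin {k} {2} i) ⟩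
    funToFin (bits i)  ≡⟨ funToFin-cong (f-injective _ _ (encode-injective eq)) ⟩
    funToFin (bits j)  ≡⟨ funToFin-finToFin {k} {2} j ⟩
    j                  ∎
    where
    open ≡-Reasoning
    bits : Fin (2 ^ k) → (Fin k → Fin 2)
    bits = finToFun

  bits-bound : ∀ k M (f : (Fin k → Fin 2) → Vec A M) →
    (∀ u v → f u ≡ f v → ∀ i → u i ≡ v i) → k ≤ q * M
  bits-bound k M f f-injective = 2^k≤q^M⇒k≤q*M q k M (2^k≤q^M k M f f-injective)

unique-length : ∀ {m} (l : List (Fin m)) → Unique l → length l ≤ m
unique-length l unique = injective⇒≤ {f = List.lookup l} (lookup-injective l unique)
  where
  lookup-injective : ∀ {A : Set} (l : List A) → Unique l →
    ∀ {i j} → List.lookup l i ≡ List.lookup l j → i ≡ j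
  lookup-injective (a ∷ l) (a∉l ∷ u) {fzero}  {fzero}  _  = refl
  lookup-injective (a ∷ l) (a∉l ∷ u) {fzero}  {fsuc j} eq = ⊥-elim (All.lookup a∉l (∈-lookup {xs = l} j) eq)
  lookup-injective (a ∷ l) (a∉l ∷ u) {fsuc i} {fzero}  eq = ⊥-elim (All.lookup a∉l (∈-lookup {xs = l} i) (sym eq))
  lookup-injective (a ∷ l) (a∉l ∷ u) {fsuc i} {fsuc j} eq = cong fsuc (lookup-injective l u eq)

unique-split : ∀ {A : Set} (q : List A) {w : A} {s} → Unique (q ++ w ∷ s) → Unique q × w ∉ q
unique-split []      _             = [] , λ ()
unique-split (a ∷ q) (a∉ ∷ unique) with unique-split q unique
... | unique-q , w∉q = All.tabulate (λ y∈q → All.lookup a∉ (∈-++⁺ˡ y∈q)) ∷ unique-q , λ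
  { (here refl) → All.lookup a∉ (∈-++⁺ʳ q (here refl)) refl
  ; (there w∈q) → w∉q w∈q }

fresh-cons : ∀ {A : Set} {x : A} {xs} → x ∉ xs → Unique xs → Unique (x ∷ xs)
fresh-cons x∉xs unique = All.tabulate (λ y∈xs x≡y → x∉xs (subst (_∈ _) (sym x≡y) y∈xs)) ∷ unique

concatFin : ∀ {A : Set} m → (Fin m → List A) → List A
concatFin zero    g = []
concatFin (suc m) g = g fzero ++ concatFin m (g ∘ fsuc)

length-concatFin : ∀ {A : Set} m (g : Fin m → List A) → length (concatFin m g) ≡ ∑ m (length ∘ g)
length-concatFin zero    g = refl
length-concatFin (suc m) g = trans (length-++ (g fzero)) (cong (length (g fzero) +_) (length-concatFin m (g ∘ fsuc)))

∈-concatFin : ∀ {A : Set} m (g : Fin m → List A) w {x} → x ∈ g w → x ∈ concatFin m g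
∈-concatFin (suc m) g fzero    x∈ = ∈-++⁺ˡ x∈
∈-concatFin (suc m) g (fsuc w) x∈ = ∈-++⁺ʳ (g fzero) (∈-concatFin m (g ∘ fsuc) w x∈)

members : ∀ {m} → Subset m → List (Fin m)
members []          = []
members (true ∷ p)  = fzero ∷ List.map fsuc (members p)
members (false ∷ p) = List.map fsuc (members p)

length-members : ∀ {m} (p : Subset m) → length (members p) ≡ ∣ p ∣
length-members []          = refl
length-members (true ∷ p)  = cong suc (trans (length-map fsuc (members p)) (length-members p))
length-members (false ∷ p) = trans (length-map fsuc (members p)) (length-members p)

∈-members : ∀ {m} (p : Subset m) {g} → g ∈ₛ p → g ∈ members p
∈-members (true ∷ p)  Vec.here      = here refl
∈-members (true ∷ p)  (Vec.there q) = there (∈-map⁺ fsuc (∈-members p q))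
∈-members (false ∷ p) (Vec.there q) = ∈-map⁺ fsuc (∈-members p q)

length-concatMap : ∀ {A B : Set} (f : A → List B) b (as : List A) → (∀ a → length (f a) ≤ b) →
  length (concatMap f as) ≤ b * length as
length-concatMap f b []       _        = z≤n
length-concatMap f b (a ∷ as) f-short =
  ≤-trans (≤-reflexive (length-++ (f a)))
    (≤-trans (+-mono-≤ (f-short a) (length-concatMap f b as f-short)) (≤-reflexive (sym (*-suc b (length as)))))

module _ (T : Graph) where

  adj-sym : ∀ {x y} → Adj T x y → Adj T y x
  adj-sym {x} {y} xy = trans (Graph.sym T y x) xy

  chain-head : ∀ {a b p} → Chain T a b p → a ∈ p
  chain-head (single _) = here refl
  chain-head (step _ _) = here refl

  cut-chain : ∀ {x y p w} → Chain T x y p → w ∈ p → w ≢ x →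
    Σ (Vtx T) λ u → Σ (List (Vtx T)) λ q → Σ (List (Vtx T)) λ s →
      Chain T x u q × Adj T u w × p ≡ q ++ w ∷ s
  cut-chain (single x) (here refl) w≢x = ⊥-elim (w≢x refl)
  cut-chain (step _ _) (here refl) w≢x = ⊥-elim (w≢x refl)
  cut-chain {x} {w = w} (step {y = y} {p = p} xy ch) (there w∈p) _ with w ≟ y
  ... | no w≢y with cut-chain ch w∈p w≢y
  ...   | u , q , s , ch' , uw , p≡ = u , x ∷ q , s , step xy ch' , uw , cong (x ∷_) p≡
  cut-chain {x} (step xy (single y))     (there _) _ | yes refl = x , x ∷ [] , [] , single x , xy , refl
  cut-chain {x} (step xy (step {p = p} _ _)) (there _) _ | yes refl = x , x ∷ [] , p , single x , xy , refl

-- Weigh a region P of G (a boolean predicate on vertices)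
-- by the number of coordinates ω places in it.  For a tree node z, vc3 splits
-- V(G) \ β(z) into the branches towards the neighbours w of z; "part P z w"
-- is the portion of P in the branch towards w.  The centroid lemma finds a node
-- all of whose parts carry at most half the mass of P.
module Separators {n : ℕ} (G : Graph) (ω : Fin n → Vtx G) (X : VertexCutTree G) where
  open VertexCutTree X

  nT : ℕ
  nT = Graph.nV T

  Location : Vtx T → Vtx G → Set
  Location z g = g ∈ₛ β z ⊎ Σ (Vtx T) λ w → Adj T z w × Branch z w g

  branchTag : ∀ {z g} → Location z g → Vtx T → Bool
  branchTag (inj₁ _)        w = false
  branchTag (inj₂ (w' , _)) w = does (w' ≟ w)

  inBranch : Vtx T → Vtx T → Vtx G → Bool
  inBranch z w g = branchTag (vc3-cover z g) w

  branchTag-sound : ∀ {z g} (loc : Location z g) w → branchTag loc w ≡ true → Adj T z w × Branch z w g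
  branchTag-sound (inj₂ (w' , zw' , br)) w tag with w' ≟ w
  ... | yes refl = zw' , br

  branchTag-complete : ∀ {z g w} (loc : Location z g) → Adj T z w → Branch z w g → branchTag loc w ≡ true
  branchTag-complete (inj₁ g∈βz) _ br = ⊥-elim (proj₂ br g∈βz)
  branchTag-complete {z} {g} {w} (inj₂ (w' , zw' , br')) zw br with w' ≟ w
  ... | yes _   = refl
  ... | no w'≢w = ⊥-elim (vc3-disjoint z w' w g zw' zw w'≢w br' br)

  branchTag-unique : ∀ {z g} (loc : Location z g) → ∑ nT (λ w → χ (branchTag loc w)) ≤ 1
  branchTag-unique (inj₁ _)        = ≤-trans (≤-reflexive (∑-zero nT (λ _ → refl))) z≤n
  branchTag-unique (inj₂ (w' , _)) = ≤-reflexive (∑-point nT w')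

  inBranch-sound : ∀ z w g → inBranch z w g ≡ true → Adj T z w × Branch z w g
  inBranch-sound z w g = branchTag-sound (vc3-cover z g) w

  inBranch-complete : ∀ z w g → Adj T z w → Branch z w g → inBranch z w g ≡ true
  inBranch-complete z w g = branchTag-complete (vc3-cover z g)

  -- For adjacent z, w the branch of z towards w and the branch of w towards z
  -- are disjoint: a vertex in both would lie in two branches at z.
  opposite-branches-disjoint : ∀ z w g → Adj T z w → Branch z w g → Branch w z g → ⊥
  opposite-branches-disjoint z w g _ (_ , g∉βz) ((y , (_ , (single .z , _) , _) , g∈βy) , _) = g∉βz g∈βy
  opposite-branches-disjoint z w g zw br@(_ , g∉βz)
    ((y , (.(z ∷ r) , (step {y = v} {p = r} zv ch , z∉r ∷ unique-r) , w∉p) , g∈βy) , _) =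
    vc3-disjoint z v w g zv zw v≢w br-v br
    where
    v≢w : v ≢ w
    v≢w refl = w∉p (there (chain-head T ch))
    br-v : Branch z v g
    br-v = (y , (r , (ch , unique-r) , λ z∈r → All.lookup z∉r z∈r refl) , g∈βy) , g∉βz

  Region : Set
  Region = Vtx G → Bool

  mass : Region → ℕ
  mass P = ∑ n (λ i → χ (P (ω i)))

  part : Region → Vtx T → Vtx T → Region
  part P z w g = P g ∧ inBranch z w g

  -- The parts of P at z are disjoint, so their masses add up to at most mass P.
  parts-mass : ∀ P z → ∑ nT (λ w → mass (part P z w)) ≤ mass P
  parts-mass P z = ≤-trans (≤-reflexive (∑-swap nT n (λ w i → χ (part P z w (ω i)))))
                           (∑-mono n (λ i → pointwise (ω i)))
    where
    pointwise : ∀ g → ∑ nT (λ w → χ (P g ∧ inBranch z w g)) ≤ χ (P g)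
    pointwise g with P g
    ... | false = ≤-reflexive (∑-zero nT (λ _ → refl))
    ... | true  = branchTag-unique (vc3-cover z g)

  opposite-parts-mass : ∀ P z w → Adj T z w → mass (part P w z) + mass (part P z w) ≤ mass P
  opposite-parts-mass P z w zw = ≤-trans (≤-reflexive (sym (∑-+ n _ _))) (∑-mono n (λ i → pointwise (ω i)))
    where
    pointwise : ∀ g → χ (P g ∧ inBranch w z g) + χ (P g ∧ inBranch z w g) ≤ χ (P g)
    pointwise g with P g
    ... | false = z≤n
    ... | true with inBranch w z g in wz | inBranch z w g in zw'
    ... | true  | true  = ⊥-elim (opposite-branches-disjoint z w g zw (proj₂ (inBranch-sound z w g zw'))
                                                                   (proj₂ (inBranch-sound w z g wz)))
    ... | true  | false = s≤s z≤n
    ... | false | true  = s≤s z≤n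
    ... | false | false = z≤n

  Heavy : Region → Vtx T → Vtx T → Set
  Heavy P z w = mass P < 2 * mass (part P z w)

  -- A heavy part is nonempty, so its direction w is a neighbour of z.
  heavy⇒adjacent : ∀ P z w → Heavy P z w → Adj T z w
  heavy⇒adjacent P z w heavy with ∑-pos n (λ i → χ (part P z w (ω i))) (double-pos heavy)
  ... | i , pos = proj₁ (inBranch-sound z w (ω i) (∧-conicalʳ (P (ω i)) _ (χ-pos pos)))

  heavy-antisymmetric : ∀ P z w → Heavy P z w → Heavy P w z → ⊥
  heavy-antisymmetric P z w zw wz = <-irrefl refl (begin-strict
      mass P + mass P <⟨ +-mono-< zw wz ⟩
      2 * a + 2 * b   ≡⟨ sym (*-distribˡ-+ 2 a b) ⟩
      2 * (a + b)     ≡⟨ cong (2 *_) (+-comm a b) ⟩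
      2 * (b + a)     ≤⟨ *-monoʳ-≤ 2 (opposite-parts-mass P z w (heavy⇒adjacent P z w zw)) ⟩
      2 * mass P      ≡⟨ cong (mass P +_) (+-identityʳ (mass P)) ⟩
      mass P + mass P ∎)
    where
    open ≤-Reasoning
    a = mass (part P z w)
    b = mass (part P w z)

  -- A walk following heavy parts, listed from its newest vertex backwards.
  data HeavyWalk (P : Region) : List (Vtx T) → Set where
    start : ∀ z → HeavyWalk P (z ∷ [])
    extend : ∀ {z w r} → Heavy P z w → HeavyWalk P (z ∷ r) → HeavyWalk P (w ∷ z ∷ r)

  heavyWalk-chain : ∀ {P z r} → HeavyWalk P (z ∷ r) → Σ (Vtx T) λ y → Chain T z y (z ∷ r)
  heavyWalk-chain (start z) = z , single z
  heavyWalk-chain {P} (extend {z} {w} zw walk) with heavyWalk-chain walk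
  ... | y , ch = y , step (adj-sym T (heavy⇒adjacent P z w zw)) ch

  -- Since T is acyclic and heavy steps never go straight back, a heavy walk never
  -- revisits a vertex: a revisit would close a cycle w, z, z', …, u, w.
  heavyWalk-unique : ∀ {P l} → HeavyWalk P l → Unique l
  heavyWalk-fresh : ∀ {P z w r} → Heavy P z w → HeavyWalk P (z ∷ r) → Unique (z ∷ r) → w ∉ z ∷ r
  heavyWalk-fresh {P} {z} {w} zw _ _ (here refl) with trans (sym (heavy⇒adjacent P z w zw)) (Graph.irrefl T z)
  ... | ()
  heavyWalk-fresh {P} {z} {w} zw (extend {z'} z'z walk) unique (there w∈) with w ≟ z'
  ... | yes refl = heavy-antisymmetric P w z z'z zw
  ... | no w≢z' with cut-chain T (proj₂ (heavyWalk-chain walk)) w∈ w≢z'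
  ...   | u , q , s , z'⋯u , uw , split = proj₂ (VertexCutTree.tree X)
          (w , u , w ∷ z ∷ q , (step wz (step zz' z'⋯u) , fresh-cons w∉zq unique-zq) , uw ,
           s≤s (s≤s (length-pos (chain-head T z'⋯u))))
    where
    wz : Adj T w z
    wz = adj-sym T (heavy⇒adjacent P z w zw)
    zz' : Adj T z z'
    zz' = adj-sym T (heavy⇒adjacent P z' z z'z)
    split-unique : Unique (z ∷ q) × w ∉ z ∷ q
    split-unique = unique-split (z ∷ q) (subst (λ l → Unique (z ∷ l)) split unique)
    unique-zq : Unique (z ∷ q)
    unique-zq = proj₁ split-unique
    w∉zq : w ∉ z ∷ q
    w∉zq = proj₂ split-unique
    length-pos : ∀ {A : Set} {x : A} {q} → x ∈ q → 1 ≤ length q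
    length-pos (here _)  = s≤s z≤n
    length-pos (there _) = s≤s z≤n

  heavyWalk-unique (start z) = [] ∷ []
  heavyWalk-unique (extend zw walk) =
    fresh-cons (heavyWalk-fresh zw walk (heavyWalk-unique walk)) (heavyWalk-unique walk)

  -- Extend a heavy walk while possible; it has at most nT vertices, so fuel
  -- nT suffices to reach a node without heavy parts.
  follow-heavy : ∀ P fuel z r → HeavyWalk P (z ∷ r) → nT < length (z ∷ r) + fuel →
    Σ (Vtx T) λ c → ∀ w → 2 * mass (part P c w) ≤ mass P
  follow-heavy P zero z r walk too-long =
    ⊥-elim (<⇒≱ (subst (nT <_) (+-identityʳ _) too-long) (unique-length (z ∷ r) (heavyWalk-unique walk)))
  follow-heavy P (suc fuel) z r walk too-long with any? (λ w → mass P <? 2 * mass (part P z w))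
  ... | no  none-heavy  = z , λ w → ≮⇒≥ (λ heavy → none-heavy (w , heavy))
  ... | yes (w , heavy) = follow-heavy P fuel w (z ∷ r) (extend heavy walk)
                            (subst (nT <_) (+-suc (length (z ∷ r)) fuel) too-long)

  centroid : Vtx T → (P : Region) → Σ (Vtx T) λ c → ∀ w → 2 * mass (part P c w) ≤ mass P
  centroid z₀ P = follow-heavy P nT z₀ [] (start z₀) ≤-refl

half-< : ∀ {m a} → 1 ≤ m → 2 * a ≤ m → a < m
half-< {m} {a} m≥1 2a≤m with a <? m
... | yes a<m = a<m
... | no  a≮m = ⊥-elim (<-irrefl refl (begin-strict
      m      <⟨ m<m+n m (s≤s z≤n) ⟩
      m + 1  ≤⟨ +-monoʳ-≤ m m≥1 ⟩
      m + m  ≤⟨ +-mono-≤ (≮⇒≥ a≮m) (≤-trans (≮⇒≥ a≮m) (≤-reflexive (sym (+-identityʳ a)))) ⟩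
      2 * a  ≤⟨ 2a≤m ⟩
      m      ∎))
  where open ≤-Reasoning

-- A heavy region of mass M ≥ d is cut
-- once, and its parts need L further cuts; H of the parts are heavy.  Summing
-- the inductive bounds over the parts gives the two hypotheses, and they yield
-- d * (L + 2) ≤ 2 M: with H = 0 there are no further cuts, with H = 1 the single
-- heavy part has mass at most M / 2, and with H ≥ 2 the first hypothesis suffices.
separator-count-step : ∀ d M L H → d ≤ M → d * L + d * H ≤ 2 * M → d * L + d * H ≤ M * H →
  d * suc (suc L) ≤ 2 * M
separator-count-step d M L zero d≤M _ bound = begin
    d * suc (suc L)   ≡⟨ *-suc d (suc L) ⟩
    d + d * suc L     ≡⟨ cong (d +_) (*-suc d L) ⟩
    d + (d + d * L)   ≡⟨ cong (λ x → d + (d + x)) dL≡0 ⟩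
    d + (d + 0)       ≤⟨ +-mono-≤ d≤M (+-monoˡ-≤ 0 d≤M) ⟩
    2 * M             ∎
  where
  open ≤-Reasoning
  dL≡0 : d * L ≡ 0
  dL≡0 = n≤0⇒n≡0 (≤-trans (m≤m+n (d * L) (d * 0)) (≤-trans bound (≤-reflexive (*-zeroʳ M))))
separator-count-step d M L (suc zero) d≤M _ bound = begin
    d * suc (suc L)      ≡⟨ *-suc d (suc L) ⟩
    d + d * suc L        ≡⟨ cong (d +_) (trans (*-suc d L) (+-comm d (d * L))) ⟩
    d + (d * L + d)      ≡⟨ cong (λ x → d + (d * L + x)) (sym (*-identityʳ d)) ⟩
    d + (d * L + d * 1)  ≤⟨ +-mono-≤ d≤M (≤-trans bound (≤-reflexive (*-identityʳ M))) ⟩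
    M + M                ≡⟨ cong (M +_) (sym (+-identityʳ M)) ⟩
    2 * M                ∎
  where open ≤-Reasoning
separator-count-step d M L (suc (suc H)) _ bound _ = begin
    d * suc (suc L)             ≡⟨ trans (*-suc d (suc L)) (cong (d +_) (*-suc d L)) ⟩
    d + (d + d * L)             ≡⟨ trans (sym (+-assoc d d (d * L))) (+-comm (d + d) (d * L)) ⟩
    d * L + (d + d)             ≤⟨ +-monoʳ-≤ (d * L) (+-monoʳ-≤ d (m≤m+n d (d * H))) ⟩
    d * L + (d + (d + d * H))   ≡⟨ cong (λ x → d * L + (d + x)) (sym (*-suc d H)) ⟩
    d * L + (d + d * suc H)     ≡⟨ cong (d * L +_) (sym (*-suc d (suc H))) ⟩
    d * L + d * suc (suc H)     ≤⟨ bound ⟩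
    2 * M                       ∎
  where open ≤-Reasoning

-- Each cut removes mass at least d from further consideration and halves the
-- parts, which gives d * (number of cuts + 1) ≤ 2 * mass.
module Decomposition {n : ℕ} (G : Graph) (ω : Fin n → Vtx G) (X : VertexCutTree G)
                     (z₀ : Vtx (VertexCutTree.T X)) (d : ℕ) (d≥1 : 1 ≤ d) where
  open VertexCutTree X
  open Separators G ω X

  centre : Region → Vtx T
  centre P = proj₁ (centroid z₀ P)

  centre-balanced : ∀ P w → 2 * mass (part P (centre P) w) ≤ mass P
  centre-balanced P = proj₂ (centroid z₀ P)

  -- The fuel bounds the recursion depth; fuel above the mass always suffices.
  mutual
    separators : ℕ → Region → List (Vtx T)
    separators zero       P = []
    separators (suc fuel) P = separators-at fuel P (mass P <? d)

    separators-at : ℕ → (P : Region) → Dec (mass P < d) → List (Vtx T)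
    separators-at fuel P (yes _) = []
    separators-at fuel P (no _)  = centre P ∷ concatFin nT (λ w → separators fuel (part P (centre P) w))

  -- The parts of a heavy region are strictly lighter, so the fuel decreases soundly.
  part-lighter : ∀ fuel P → mass P < suc fuel → ¬ mass P < d → ∀ w → mass (part P (centre P) w) < fuel
  part-lighter fuel P fuel-ok heavy w =
    ≤-trans (half-< (≤-trans d≥1 (≮⇒≥ heavy)) (centre-balanced P w)) (≤-pred fuel-ok)

  CountBound : List (Vtx T) → Region → Set
  CountBound L P = (mass P < d → length L ≡ 0) × (d ≤ mass P → d * suc (length L) ≤ 2 * mass P)

  -- What one part contributes to the bounds of separator-count-step.
  part-contribution : ∀ L m M → (m < d → L ≡ 0) → (d ≤ m → d * suc L ≤ 2 * m) → 2 * m ≤ M →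
    (heavy? : Dec (d ≤ m)) → let h = χ (does heavy?) in (d * L + d * h ≤ 2 * m) × (d * L + d * h ≤ M * h)
  part-contribution L m M light heavy 2m≤M (yes d≤m) =
    bound , ≤-trans bound (≤-trans 2m≤M (≤-reflexive (sym (*-identityʳ M))))
    where
    bound : d * L + d * 1 ≤ 2 * m
    bound = ≤-trans (≤-reflexive (trans (cong (d * L +_) (*-identityʳ d))
                                        (trans (+-comm _ d) (sym (*-suc d L))))) (heavy d≤m)
  part-contribution L m M light heavy 2m≤M (no d≰m) rewrite light (≰⇒> d≰m) | *-zeroʳ d = z≤n , z≤n

  mutual
    separators-count : ∀ fuel P → mass P < fuel → CountBound (separators fuel P) P
    separators-count (suc fuel) P fuel-ok = separators-at-count fuel P fuel-ok (mass P <? d)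

    separators-at-count : ∀ fuel P → mass P < suc fuel → (dec : Dec (mass P < d)) →
      CountBound (separators-at fuel P dec) P
    separators-at-count fuel P _ (yes light) = (λ _ → refl) , (λ d≤m → ⊥-elim (<⇒≱ light d≤m))
    separators-at-count fuel P fuel-ok (no heavy) = (λ light → ⊥-elim (heavy light)) , cut-count
      where
      Ls : Fin nT → List (Vtx T)
      Ls w = separators fuel (part P (centre P) w)
      m : Fin nT → ℕ
      m w = mass (part P (centre P) w)
      h : Fin nT → ℕ
      h w = χ (does (d ≤? m w))
      L H : ℕ
      L = ∑ nT (length ∘ Ls)
      H = ∑ nT h
      contribution : ∀ w → let s = d * length (Ls w) + d * h w in (s ≤ 2 * m w) × (s ≤ mass P * h w)
      contribution w with separators-count fuel (part P (centre P) w) (part-lighter fuel P fuel-ok heavy w)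
      ... | light , bound = part-contribution (length (Ls w)) (m w) (mass P) light bound (centre-balanced P w) (d ≤? m w)
      by-mass : d * L + d * H ≤ 2 * mass P
      by-mass = ≤-trans (∑-linear-bound nT d _ h 2 m (proj₁ ∘ contribution))
                        (*-monoʳ-≤ 2 (parts-mass P (centre P)))
      by-heaviness : d * L + d * H ≤ mass P * H
      by-heaviness = ∑-linear-bound nT d _ h (mass P) h (proj₂ ∘ contribution)
      cut-count : d ≤ mass P → d * suc (suc (length (concatFin nT Ls))) ≤ 2 * mass P
      cut-count d≤m = subst (λ x → d * suc (suc x) ≤ 2 * mass P) (sym (length-concatFin nT Ls))
                        (separator-count-step d (mass P) L H d≤m by-mass by-heaviness)

-- Let (x, s) be in the full behaviour of a realization of
-- a code of minimum distance d.  If (x, s) vanishes at every vertex of β(c) for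
-- every separator c of the decomposition, then x = 0: each light region left by
-- the decomposition is closed (its boundary vertices vanish), and cutting (x, s)
-- down to a closed light region gives a codeword of weight < d, hence zero.
module Vanishing (F : FiniteField) {n : ℕ} (C : Code F n) (G : Graph) (ω : Fin n → Vtx G)
                 (X : VertexCutTree G) (Γ : GraphicalModel F n G ω) (realizes : GraphicalModel.Realizes Γ C)
                 (d : ℕ) (min-dist : MinDist F C d) (d≥1 : 1 ≤ d) (z₀ : Vtx (VertexCutTree.T X)) where
  open VertexCutTree X
  open Separators G ω X
  open Decomposition G ω X z₀ d d≥1
  open GraphicalModel Γ
  open FiniteField F using (Carrier; 0#) renaming (_≟_ to _≟F_)
  open WeightFacts F

  true≢false : true ≢ false
  true≢false ()

  kept : ∀ {b} (a : Carrier) → b ≡ true → a ≡ (if b then a else 0#)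
  kept a refl = refl

  dropped : ∀ {b} (a : Carrier) → b ≡ false → 0# ≡ (if b then a else 0#)
  dropped a refl = refl

  module _ (x : Fin n → Carrier) (s : States) (behaves : InBehavior x s) where

    Vanishes : Vtx G → Set
    Vanishes g = ∀ j → restrict x s g j ≡ 0#

    Closed : Region → Set
    Closed P = ∀ g g' → Adj G g g' → P g ≡ true → P g' ≡ true ⊎ Vanishes g'

    cut-x : Region → Fin n → Carrier
    cut-x P i = if P (ω i) then x i else 0#

    cut-s : Region → States
    cut-s P e k = if P (proj₁ (proj₁ e)) ∨ P (proj₂ (proj₁ e)) then s e k else 0#

    cut-inside : ∀ P v → P v ≡ true → ∀ j → restrict x s v j ≡ restrict (cut-x P) (cut-s P) v j
    cut-inside P v Pv (inj₁ (i , refl))                      = kept (x i) Pv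
    cut-inside P v Pv (inj₂ (((a , b) , _) , inj₁ refl , k)) = kept (s _ k) (cong (_∨ P b) Pv)
    cut-inside P v Pv (inj₂ (((a , b) , _) , inj₂ refl , k)) = kept (s _ k) (trans (cong (P a ∨_) Pv) (∨-zeroʳ (P a)))

    -- Outside a closed P it is zero: an edge from v ∉ P into P makes v vanish.
    cut-outside : ∀ P v → Closed P → P v ≡ false → ∀ j → 0# ≡ restrict (cut-x P) (cut-s P) v j
    cut-outside P v closed Pv (inj₁ (i , refl)) = dropped (x i) Pv
    cut-outside P v closed Pv j@(inj₂ (((a , b) , _ , ab) , inc , k)) with P a ∨ P b in touches
    ... | false = refl
    cut-outside P v closed Pv j@(inj₂ (((a , b) , _ , ab) , inj₁ refl , k)) | true
      with closed b a (trans (Graph.sym G b a) ab) (trans (sym (cong (_∨ P b) Pv)) touches)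
    ...   | inj₁ Pa  = ⊥-elim (true≢false (trans (sym Pa) Pv))
    ...   | inj₂ van = sym (van j)
    cut-outside P v closed Pv j@(inj₂ (((a , b) , _ , ab) , inj₂ refl , k)) | true
      with closed a b ab (trans (sym (∨-identityʳ (P a))) (trans (cong (P a ∨_) (sym Pv)) touches))
    ...   | inj₁ Pb  = ⊥-elim (true≢false (trans (sym Pb) Pv))
    ...   | inj₂ van = sym (van j)

    cut-behaves : ∀ P → Closed P → InBehavior (cut-x P) (cut-s P)
    cut-behaves P closed v with P v in Pv
    ... | true  = Subspace.mem-ext (Cv v) (behaves v) (cut-inside P v Pv)
    ... | false = Subspace.mem-ext (Cv v) (Subspace.mem-0 (Cv v)) (cut-outside P v closed Pv)

    light-closed-vanishes : ∀ P → Closed P → mass P < d → ∀ i → P (ω i) ≡ true → x i ≡ 0#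
    light-closed-vanishes P closed light i Pi with cut-x P i ≟F 0#
    ... | yes cut≡0 = trans (kept (x i) Pi) cut≡0
    ... | no  cut≢0 = ⊥-elim (<⇒≱ light (≤-trans (proj₂ min-dist (cut-x P) codeword (i , cut≢0))
                                                   (weight-≤-support (cut-x P) (λ i → P (ω i)) outside)))
      where
      codeword : Subspace.mem C (cut-x P)
      codeword = Equivalence.from (proj₂ realizes (cut-x P)) (cut-x P , cut-s P , cut-behaves P closed , λ _ → refl)
      outside : ∀ i → P (ω i) ≡ false → cut-x P i ≡ 0#
      outside i Pi = sym (dropped (x i) Pi)

    part-closed : ∀ P z → Closed P → (∀ g → g ∈ₛ β z → Vanishes g) → ∀ w → Closed (part P z w)
    part-closed P z closed βz-vanishes w g g' gg' in-part
      with inBranch-sound z w g (∧-conicalʳ (P g) _ in-part)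
    ... | zw , branch with closed g g' gg' (∧-conicalˡ (P g) _ in-part)
    ...   | inj₂ van = inj₂ van
    ...   | inj₁ Pg' with vc3-star z w g g' zw branch gg'
    ...     | inj₁ branch' = inj₁ (trans (cong (_∧ inBranch z w g') Pg') (inBranch-complete z w g' zw branch'))
    ...     | inj₂ g'∈βz   = inj₂ (βz-vanishes g' g'∈βz)

    mutual
      vanishes-off-separators : ∀ fuel P → mass P < fuel → Closed P →
        (∀ z → z ∈ separators fuel P → ∀ g → g ∈ₛ β z → Vanishes g) →
        ∀ i → P (ω i) ≡ true → x i ≡ 0#
      vanishes-off-separators (suc fuel) P fuel-ok closed =
        vanishes-off-separators-at fuel P fuel-ok closed (mass P <? d)

      vanishes-off-separators-at : ∀ fuel P → mass P < suc fuel → Closed P → (light? : Dec (mass P < d)) →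
        (∀ z → z ∈ separators-at fuel P light? → ∀ g → g ∈ₛ β z → Vanishes g) →
        ∀ i → P (ω i) ≡ true → x i ≡ 0#
      vanishes-off-separators-at fuel P _ closed (yes light) _ = light-closed-vanishes P closed light
      vanishes-off-separators-at fuel P fuel-ok closed (no heavy) sep-vanishes i Pi =
        by-location (vc3-cover c (ω i))
        where
        c : Vtx T
        c = centre P
        βc-vanishes : ∀ g → g ∈ₛ β c → Vanishes g
        βc-vanishes = sep-vanishes c (here refl)
        by-location : Location c (ω i) → x i ≡ 0#
        by-location (inj₁ ωi∈βc) = βc-vanishes (ω i) ωi∈βc (inj₁ (i , refl))
        by-location (inj₂ (w , cw , branch)) =
          vanishes-off-separators fuel (part P c w) (part-lighter fuel P fuel-ok heavy w)
            (part-closed P c closed βc-vanishes w)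
            (λ z z∈ → sep-vanishes z (there (∈-concatFin nT (λ w' → separators fuel (part P c w')) w z∈))) i
            (trans (cong (_∧ inBranch c w (ω i)) Pi) (inBranch-complete c w (ω i) cw branch))

-- Decompose the whole vertex set by separators
-- c₁, …, c_L (so that d * L ≤ 2 n).  By the vanishing lemma, a codeword is
-- determined by the local data of its behaviour at the at most ℓ L vertices
-- of β(c₁) ∪ … ∪ β(c_L), each described by at most t coordinates over F.
-- Encoding 2^k codewords this way gives k ≤ |F| t ℓ L.
module DimensionBound (F : FiniteField) (ℓ t : ℕ) {n : ℕ} (C : Code F n) (G : Graph) (ω : Fin n → Vtx G)
    (X : VertexCutTree G) (narrow : VertexCutTree.vcWidthAtMost X ℓ)
    (Γ : GraphicalModel F n G ω) (realizes : GraphicalModel.Realizes Γ C) (small : GraphicalModel.κAtMost Γ t)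
    (d : ℕ) (min-dist : MinDist F C d) (d≥1 : 1 ≤ d) (z₀ : Vtx (VertexCutTree.T X))
    (k : ℕ) (dim : HasDim F C k) where
  open VertexCutTree X
  open Separators G ω X
  open Decomposition G ω X z₀ d d≥1
  open Vanishing F C G ω X Γ realizes d min-dist d≥1 z₀
  open GraphicalModel Γ
  open FiniteField F using (Carrier; 0#; elements; complete)
  open FieldFacts F using (_−_; bit; bit-injective; mem-−; lincomb-mem; lincomb-injective; x−x≡0; x−y≡0⇒x≡y)

  q : ℕ
  q = length elements

  everything : Region
  everything _ = true

  mass-everything : mass everything ≡ n
  mass-everything = ∑-one n

  seps : List (Vtx T)
  seps = separators (suc n) everything

  few-separators : d * length seps ≤ 2 * n
  few-separators = subst (λ m → d * length seps ≤ 2 * m) mass-everything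
    (by-size (separators-count (suc n) everything (s≤s (≤-reflexive mass-everything))) (d ≤? mass everything))
    where
    by-size : CountBound seps everything → Dec (d ≤ mass everything) → d * length seps ≤ 2 * mass everything
    by-size (light , _)     (no d≰m)  =
      ≤-trans (≤-reflexive (trans (cong (d *_) (light (≰⇒> d≰m))) (*-zeroʳ d))) z≤n
    by-size (_     , heavy) (yes d≤m) = ≤-trans (*-monoʳ-≤ d (n≤1+n _)) (heavy d≤m)

  boundary : List (Vtx G)
  boundary = concatMap (members ∘ β) seps

  boundary-size : length boundary ≤ ℓ * length seps
  boundary-size = length-concatMap (members ∘ β) ℓ seps
    (λ z → ≤-trans (≤-reflexive (length-members (β z))) (narrow z))

  ∈-boundary : ∀ z → z ∈ seps → ∀ g → g ∈ₛ β z → g ∈ boundary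
  ∈-boundary z z∈seps g g∈βz =
    ∈-concatMap⁺ (members ∘ β) (Any.map (λ { refl → ∈-members (β z) g∈βz }) z∈seps)

  localDim : Vtx G → ℕ
  localDim g = proj₁ (small g)

  localBasis : (g : Vtx G) → Vec (LocalIdx F G ω stDim g → Carrier) (localDim g)
  localBasis g = proj₁ (proj₂ (proj₂ (small g)))

  coordinates : ∀ g y → Subspace.mem (Cv g) y →
    Σ (Vec Carrier (localDim g)) λ c → ∀ j → lincomb F c (localBasis g) j ≡ y j
  coordinates g = proj₂ (proj₂ (proj₂ (proj₂ (proj₂ (small g)))))

  totalDim : List (Vtx G) → ℕ
  totalDim []       = 0
  totalDim (g ∷ gs) = localDim g + totalDim gs

  totalDim-≤ : ∀ gs → totalDim gs ≤ t * length gs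
  totalDim-≤ []       = z≤n
  totalDim-≤ (g ∷ gs) = ≤-trans (+-mono-≤ (proj₁ (proj₂ (small g))) (totalDim-≤ gs))
                                (≤-reflexive (sym (*-suc t (length gs))))

  codeword : (Fin k → Fin 2) → Fin n → Carrier
  codeword u = lincomb F (tabulate (bit ∘ u)) (proj₁ dim)

  extension : ∀ u → Σ (Fin n → Carrier) λ x → Σ States λ s → InBehavior x s × (∀ i → x i ≡ codeword u i)
  extension u = Equivalence.to (proj₂ realizes (codeword u))
                  (lincomb-mem C (tabulate (bit ∘ u)) (proj₁ dim) (proj₁ (proj₂ dim)))

  xᵘ : (Fin k → Fin 2) → Fin n → Carrier
  xᵘ u = proj₁ (extension u)

  sᵘ : (Fin k → Fin 2) → States
  sᵘ u = proj₁ (proj₂ (extension u))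

  behavesᵘ : ∀ u → InBehavior (xᵘ u) (sᵘ u)
  behavesᵘ u = proj₁ (proj₂ (proj₂ (extension u)))

  coordinatesᵘ : ∀ u g → Σ (Vec Carrier (localDim g)) λ c →
    ∀ j → lincomb F c (localBasis g) j ≡ restrict (xᵘ u) (sᵘ u) g j
  coordinatesᵘ u g = coordinates g (restrict (xᵘ u) (sᵘ u) g) (behavesᵘ u g)

  localData : (gs : List (Vtx G)) → (Fin k → Fin 2) → Vec Carrier (totalDim gs)
  localData []       u = []
  localData (g ∷ gs) u = proj₁ (coordinatesᵘ u g) ++ᵥ localData gs u

  localData-determines : ∀ gs u v → localData gs u ≡ localData gs v → ∀ g → g ∈ gs → ∀ j →
    restrict (xᵘ u) (sᵘ u) g j ≡ restrict (xᵘ v) (sᵘ v) g j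
  localData-determines (g ∷ gs) u v same g' g'∈ j
    with ++-injective (proj₁ (coordinatesᵘ u g)) (proj₁ (coordinatesᵘ v g)) same
  ... | same-here , same-rest with g'∈
  ...   | there g'∈gs = localData-determines gs u v same-rest g' g'∈gs j
  ...   | here refl   = begin
    restrict (xᵘ u) (sᵘ u) g j                        ≡⟨ sym (proj₂ (coordinatesᵘ u g) j) ⟩
    lincomb F (proj₁ (coordinatesᵘ u g)) (localBasis g) j ≡⟨ cong (λ c → lincomb F c (localBasis g) j) same-here ⟩
    lincomb F (proj₁ (coordinatesᵘ v g)) (localBasis g) j ≡⟨ proj₂ (coordinatesᵘ v g) j ⟩
    restrict (xᵘ v) (sᵘ v) g j                        ∎
    where open ≡-Reasoning

  module Difference (u v : Fin k → Fin 2) where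
    xᵈ : Fin n → Carrier
    xᵈ i = xᵘ u i − xᵘ v i

    sᵈ : States
    sᵈ e j = sᵘ u e j − sᵘ v e j

    restrict-difference : ∀ g j →
      restrict xᵈ sᵈ g j ≡ restrict (xᵘ u) (sᵘ u) g j − restrict (xᵘ v) (sᵘ v) g j
    restrict-difference g (inj₁ _) = refl
    restrict-difference g (inj₂ _) = refl

    behavesᵈ : InBehavior xᵈ sᵈ
    behavesᵈ g = Subspace.mem-ext (Cv g) (mem-− (Cv g) (behavesᵘ u g) (behavesᵘ v g))
                   (λ j → sym (restrict-difference g j))

  localData-injective : ∀ u v → localData boundary u ≡ localData boundary v → ∀ i → u i ≡ v i
  localData-injective u v same i = bit-injective (begin
    bit (u i)                     ≡⟨ sym (lookup∘tabulate (bit ∘ u) i) ⟩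
    lookup (tabulate (bit ∘ u)) i ≡⟨ lincomb-injective (proj₁ dim) (proj₁ (proj₂ (proj₂ dim)))
                                       (tabulate (bit ∘ u)) (tabulate (bit ∘ v)) same-codeword i ⟩
    lookup (tabulate (bit ∘ v)) i ≡⟨ lookup∘tabulate (bit ∘ v) i ⟩
    bit (v i)                     ∎)
    where
    open ≡-Reasoning
    open Difference u v
    boundary-vanishes : ∀ z → z ∈ seps → ∀ g → g ∈ₛ β z → Vanishes xᵈ sᵈ behavesᵈ g
    boundary-vanishes z z∈seps g g∈βz j =
      trans (restrict-difference g j)
        (trans (cong (_− _) (localData-determines boundary u v same g (∈-boundary z z∈seps g g∈βz) j))
               (x−x≡0 _))
    same-x : ∀ i → xᵘ u i ≡ xᵘ v i
    same-x i = x−y≡0⇒x≡y _ _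
      (vanishes-off-separators xᵈ sᵈ behavesᵈ (suc n) everything (s≤s (≤-reflexive mass-everything))
        (λ _ _ _ _ → inj₁ refl) boundary-vanishes i refl)
    same-codeword : ∀ i → codeword u i ≡ codeword v i
    same-codeword i = trans (sym (proj₂ (proj₂ (proj₂ (extension u))) i))
                            (trans (same-x i) (proj₂ (proj₂ (proj₂ (extension v))) i))

  position : Carrier → Fin q
  position a = index (complete a)

  position-injective : ∀ {a b} → position a ≡ position b → a ≡ b
  position-injective {a} {b} eq =
    trans (lookup-index (complete a)) (trans (cong (List.lookup elements) eq) (sym (lookup-index (complete b))))

  dimension-bound : k ≤ q * (t * (ℓ * length seps))
  dimension-bound =
    ≤-trans (Counting.bits-bound q position position-injective k _ (localData boundary) localData-injective)
            (*-monoʳ-≤ q (≤-trans (totalDim-≤ boundary) (*-monoʳ-≤ t boundary-size)))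

constant : FiniteField → ℕ → ℕ → ℕ
constant F ℓ t = length (FiniteField.elements F) * (t * ℓ)

rate-distance-bound : ∀ (F : FiniteField) ℓ t {n} (C : Code F n) → κGℓAtMost F ℓ C t → 1 ≤ n →
  ∀ {k d} → HasDim F C k → MinDist F C d → k * d ≤ constant F ℓ t * (2 * n)
rate-distance-bound F ℓ t {n} C (G , (_ , X , narrow) , ω , Γ , realizes , small) n≥1 {k} {d} dim min-dist =
  begin
    k * d                    ≤⟨ *-monoˡ-≤ d dimension-bound ⟩
    (q * (t * (ℓ * L))) * d  ≡⟨ regroup q t ℓ L d ⟩
    (q * (t * ℓ)) * (d * L)  ≤⟨ *-monoʳ-≤ (q * (t * ℓ)) few-separators ⟩
    (q * (t * ℓ)) * (2 * n)  ∎
  where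
  -- A nonzero codeword of weight d exists, so d ≥ 1.
  d≥1 : 1 ≤ d
  d≥1 with proj₁ min-dist
  ... | x , _ , (i , xi≢0) , weight≡d = subst (1 ≤_) weight≡d (WeightFacts.weight-pos F x i xi≢0)
  -- Any node of the tree serves as the start of the centroid search.
  z₀ : Vtx (VertexCutTree.T X)
  z₀ = proj₁ (VertexCutTree.vc1 X (ω (fromℕ< n≥1)))
  open DimensionBound F ℓ t C G ω X narrow Γ realizes small d min-dist d≥1 z₀ k dim
  L : ℕ
  L = length seps
  open ≤-Reasoning
  open +-*-Solver
  regroup : ∀ q t ℓ L d → (q * (t * (ℓ * L))) * d ≡ (q * (t * ℓ)) * (d * L)
  regroup = solve 5 (λ q t ℓ L d → (q :* (t :* (ℓ :* L))) :* d := (q :* (t :* ℓ)) :* (d :* L)) refl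

length-bound : ∀ a b n k d Q → 1 ≤ a → 1 ≤ n → a * n ≤ b * k → a * n ≤ b * d → k * d ≤ Q * (2 * n) →
  n ≤ (b * b) * (Q * 2)
length-bound a@(suc _) b n@(suc _) k d Q _ _ rate distance product =
  *-cancelʳ-≤ n ((b * b) * (Q * 2)) n (begin
    n * n                   ≤⟨ *-mono-≤ (m≤n*m n a) (m≤n*m n a) ⟩
    (a * n) * (a * n)       ≤⟨ *-mono-≤ rate distance ⟩
    (b * k) * (b * d)       ≡⟨ solve 3 (λ b k d → (b :* k) :* (b :* d) := (b :* b) :* (k :* d)) refl b k d ⟩
    (b * b) * (k * d)       ≤⟨ *-monoʳ-≤ (b * b) product ⟩
    (b * b) * (Q * (2 * n)) ≡⟨ solve 3 (λ b Q n → (b :* b) :* (Q :* (con 2 :* n))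
                                                := ((b :* b) :* (Q :* con 2)) :* n) refl b Q n ⟩
    ((b * b) * (Q * 2)) * n ∎)
  where
  open ≤-Reasoning
  open +-*-Solver

-- Corollary 6.12: pick a code of the sequence beyond index N and longer than
-- 2 b² |F| t ℓ; the main estimate and length-bound contradict its length.
corollary6p12 : (F : FiniteField) (ℓ t : ℕ) → 0 < ℓ → 0 < t →
    (𝔉 : CodeFamily F) →
    (∀ n (C : Code F n) → 𝔉 n C → κGℓAtMost F ℓ C t) →
    ¬ AsymptoticallyGood F 𝔉
corollary6p12 F ℓ t _ _ 𝔉 bounded (ns , cs , in-family , unbounded , (a , b , a≥1 , _ , N , good))
  with unbounded (suc ((b * b) * (constant F ℓ t * 2)))
... | M , long-enough with good (N + M) (m≤m+n N M)
...   | (k , dim , rate) , (d , min-dist , distance) =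
  <⇒≱ long (length-bound a b n k d (constant F ℓ t) a≥1 n≥1 rate distance product)
  where
  n : ℕ
  n = ns (N + M)
  long : (b * b) * (constant F ℓ t * 2) < n
  long = long-enough (N + M) (m≤n+m M N)
  n≥1 : 1 ≤ n
  n≥1 = ≤-trans (s≤s z≤n) long
  product : k * d ≤ constant F ℓ t * (2 * n)
  product = rate-distance-bound F ℓ t (cs (N + M)) (bounded n (cs (N + M)) (in-family (N + M))) n≥1 dim min-dist
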